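{- Let $\tau$ be a square-tiled surface on $[n]$ and let $c$ be a fusion path in $\tau$. Let $U\subseteq[n]$ be the union of the $\{G,B\}$-components of $\tau$ that intersect $c$. Then in each of the square-tiled surfaces $\operatorname{Shear}_{c,R,G}(\tau)$ and $\operatorname{Shear}_{c,G,R}(\tau)$, the set $U$ forms a single $\{G,B\}$-component.
   Context: A square-tiled surface on $[n]$ is a triple $\tau=(\tau_R,\tau_G,\tau_B)$ of involutions of $[n]$ (fixed points allowed) acting transitively. Its dual cubic graph $S^*(\tau)$ has vertex set $[n]$, an edge of colour $c$ for each transposition of $\tau_c$ and a half-edge of colour $c$ at each fixed point of $\tau_c$. An $\{i,j\}$-component is an orbit of $\langle\tau_i,\tau_j\rangle$; in $S^*(\tau)$ it is a path or a cycle ($\{i,j\}$-path or $\{i,j\}$-cycle). $\operatorname{Shear}_{c,i,j}(\tau)$ replaces $\tau_i|_c$ by $\tau_j|_c$ and $\tau_j|_c$ by $(\tau_j\tau_i\tau_j)|_c$. A fusion path is an $\{R,G\}$-component $c$ that is a path and such that its intersection with each $\{G,B\}$-cycle is either empty or a single green edge, and its intersection with each $\{G,B\}$-path is either empty or a single green half-edge. -}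

module Defs where

open import Data.Nat using (ℕ)
open import Data.Fin using (Fin)
open import Data.Bool using (Bool; true; false; if_then_else_; _∨_)
open import Data.Product using (Σ; ∃; _×_; _,_)
open import Data.Sum using (_⊎_)
open import Relation.Binary.PropositionalEquality using (_≡_; _≢_)
open import Relation.Nullary using (¬_)
open import Function.Bundles using (_⇔_)

data Colour : Set where
  R G B : Colour

_==_ : Colour → Colour → Bool
R == R = true
G == G = true
B == B = true
_ == _ = false

Triple : ℕ → Set
Triple n = Colour → Fin n → Fin n

-- Orbit S τ x y : y lies in the orbit of x under the group generated by
-- the maps τ k with S k ≡ true.  (All maps considered are involutions, so
-- inverses of generators are generators and reachability is the orbit relation.)
data Orbit {n : ℕ} (S : Colour → Bool) (τ : Triple n) (x : Fin n) : Fin n → Set where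
  here : Orbit S τ x x
  step : ∀ {y} k → S k ≡ true → Orbit S τ x y → Orbit S τ x (τ k y)

allColours : Colour → Bool
allColours _ = true

record SquareTiled (n : ℕ) : Set where
  field
    τ          : Triple n
    involutive : ∀ k x → τ k (τ k x) ≡ x
    transitive : ∀ x y → Orbit allColours τ x y

pair : Colour → Colour → Colour → Bool
pair i j k = (k == i) ∨ (k == j)

Comp : {n : ℕ} → Colour → Colour → Triple n → Fin n → Fin n → Set
Comp i j τ x = Orbit (pair i j) τ x

-- The {i,j}-component of x is a path in S*(τ): it carries a half-edge
-- of colour i or j, i.e. contains a fixed point of τ i or τ j.
IsPath : {n : ℕ} → Colour → Colour → Triple n → Fin n → Set
IsPath i j τ x = ∃ λ y → Comp i j τ x y × (τ i y ≡ y ⊎ τ j y ≡ y)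

IsCycle : {n : ℕ} → Colour → Colour → Triple n → Fin n → Set
IsCycle i j τ x = ¬ IsPath i j τ x

InBoth : {n : ℕ} → Triple n → (Fin n → Bool) → Fin n → Fin n → Set
InBoth τ c x y = (c y ≡ true) × Comp G B τ x y

FusionPath : {n : ℕ} → Triple n → (Fin n → Bool) → Set
FusionPath {n} τ c =
  Σ (Fin n) λ x₀ →
    (∀ y → (c y ≡ true) ⇔ Comp R G τ x₀ y)
    × IsPath R G τ x₀
    × (∀ x → IsCycle G B τ x →
         (∀ y → ¬ InBoth τ c x y)
         ⊎ (∃ λ z → (τ G z ≢ z) × (∀ y → InBoth τ c x y ⇔ (y ≡ z ⊎ y ≡ τ G z))))
    × (∀ x → IsPath G B τ x →
         (∀ y → ¬ InBoth τ c x y)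
         ⊎ (∃ λ z → (τ G z ≡ z) × (∀ y → InBoth τ c x y ⇔ (y ≡ z))))

Shear : {n : ℕ} → (Fin n → Bool) → Colour → Colour → Triple n → Triple n
Shear c i j τ k x =
  if c x
  then (if k == i then τ j x
        else if k == j then τ j (τ i (τ j x))
        else τ k x)
  else τ k x

UnionGB : {n : ℕ} → Triple n → (Fin n → Bool) → Fin n → Set
UnionGB τ c y = ∃ λ z → (c z ≡ true) × Comp G B τ z y

SingleGBComponent : {n : ℕ} → Triple n → (Fin n → Set) → Set
SingleGBComponent {n} σ U = Σ (Fin n) λ x₀ → ∀ y → U y ⇔ Comp G B σ x₀ y

{-# OPTIONS --safe #-}
-- Both shears leave τ B alone and change τ G only on c, which stays closed under
-- the new green map; so U is also the union of the new {G,B}-components meeting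
-- c, and it suffices that c lies in a single new {G,B}-component.  On c the new
-- green map is τ R for Shear(G,R) and τ G τ R τ G for Shear(R,G); in both cases
-- the red edges of c become connected once every old green edge {y, τ G y} of c
-- does.  Such an edge lies on a {G,B}-cycle meeting c in nothing else, and the
-- rest of that cycle, which the shear does not touch, still joins y to τ G y.
module Submission where

open import Defs
open import Data.Nat using (ℕ; zero; suc; _<_; s≤s)
open import Data.Nat.GeneralisedArithmetic using (fold; iterate-is-fold)
open import Data.Nat.Properties using (n<1+n)
open import Data.Fin using (Fin; toℕ)
open import Data.Fin.Properties using (pigeonhole; _≟_)
open import Data.Bool using (Bool; true; false)
open import Data.Product using (_×_; ∃; _,_; proj₁; proj₂)
open import Data.Sum using (_⊎_; inj₁; inj₂)
open import Data.Empty using (⊥-elim)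
open import Function.Base using (_∘_)
open import Function.Bundles using (_⇔_; mk⇔; module Equivalence)
open import Function.Definitions using (Injective)
open import Relation.Nullary using (¬_; yes; no)
open import Relation.Binary.PropositionalEquality
  using (_≡_; _≢_; refl; sym; trans; cong; subst; module ≡-Reasoning)

open ≡-Reasoning
open Equivalence

private
  variable
    n : ℕ

Orbit-trans : {S : Colour → Bool} {τ : Triple n} {x y z : Fin n} →
  Orbit S τ x y → Orbit S τ y z → Orbit S τ x z
Orbit-trans p here         = p
Orbit-trans p (step k e q) = step k e (Orbit-trans p q)

Orbit-sym : {S : Colour → Bool} {τ : Triple n} →
  (∀ k → S k ≡ true → ∀ x → τ k (τ k x) ≡ x) →
  ∀ {x y} → Orbit S τ x y → Orbit S τ y x
Orbit-sym inv here = here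
Orbit-sym {S = S} {τ} inv (step {y} k e p) =
  Orbit-trans (subst (Orbit S τ (τ k y)) (inv k e y) (step k e here)) (Orbit-sym inv p)

injective⇒periodic : {f : Fin n → Fin n} → Injective _≡_ _≡_ f →
  ∀ x → ∃ λ m → fold x f (suc m) ≡ x
injective⇒periodic {n} {f} f-inj x
  with i , j , i<j , fᵢ≡fⱼ ← pigeonhole (n<1+n n) (λ (i : Fin (suc n)) → fold x f (toℕ i))
  = period-from-collision (toℕ i) (toℕ j) i<j fᵢ≡fⱼ
  where
  period-from-collision : ∀ a b → a < b → fold x f a ≡ fold x f b →
    ∃ λ m → fold x f (suc m) ≡ x
  period-from-collision zero    (suc m) _         e = m , sym e
  period-from-collision (suc a) (suc b) (s≤s a<b) e = period-from-collision a b a<b (f-inj e)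

fold-shift : {A : Set} (f : A → A) (x : A) (k : ℕ) → fold (f x) f k ≡ fold x f (suc k)
fold-shift f x k = trans (iterate-is-fold (f x) f k) (sym (iterate-is-fold x f (suc k)))

Shear-off : (c : Fin n → Bool) (i j : Colour) (τ : Triple n) (k : Colour) {x : Fin n} →
  c x ≡ false → Shear c i j τ k x ≡ τ k x
Shear-off c i j τ k e rewrite e = refl

Shear-third : (c : Fin n → Bool) (i j : Colour) (τ : Triple n) {k : Colour} (x : Fin n) →
  (k == i) ≡ false → (k == j) ≡ false → Shear c i j τ k x ≡ τ k x
Shear-third c i j τ x k≠i k≠j with c x
... | true rewrite k≠i | k≠j = refl
... | false = refl

-- A G-step of ρ out of a vertex of c is replaced by restarting the walk at
-- its endpoint, which again lies in c.
UnionGB-transfer : {ρ ρ′ : Triple n} {c : Fin n → Bool} →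
  (∀ x → ρ B x ≡ ρ′ B x) → (∀ x → c x ≡ false → ρ G x ≡ ρ′ G x) →
  (∀ x → c x ≡ true → c (ρ G x) ≡ true) →
  ∀ {y} → UnionGB ρ c y → UnionGB ρ′ c y
UnionGB-transfer {ρ = ρ} {ρ′} {c} agree-B agree-G closed-G (z , cz , p) = go p
  where
  go : ∀ {y} → Comp G B ρ z y → UnionGB ρ′ c y
  go here = z , cz , here
  go (step {y} B _ p) with w , cw , q ← go p =
    w , cw , subst (Comp G B ρ′ w) (sym (agree-B y)) (step B refl q)
  go (step {y} G _ p) with c y in cy
  ... | true  = ρ G y , closed-G y cy , here
  ... | false with w , cw , q ← go p =
    w , cw , subst (Comp G B ρ′ w) (sym (agree-G y cy)) (step G refl q)

IsPath-backwards : {i j : Colour} {τ : Triple n} {x y : Fin n} →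
  Comp i j τ x y → IsPath i j τ y → IsPath i j τ x
IsPath-backwards p (w , q , half-edge) = w , Orbit-trans p q , half-edge

module Rotation (T : SquareTiled n) where
  open SquareTiled T

  rotate : Fin n → Fin n
  rotate = τ B ∘ τ G

  rotate-injective : Injective _≡_ _≡_ rotate
  rotate-injective {a} {b} e = begin
    a                     ≡⟨ unrotate a ⟨
    τ G (τ B (rotate a))  ≡⟨ cong (τ G ∘ τ B) e ⟩
    τ G (τ B (rotate b))  ≡⟨ unrotate b ⟩
    b                     ∎
    where
    unrotate : ∀ x → τ G (τ B (rotate x)) ≡ x
    unrotate x = trans (cong (τ G) (involutive B (τ G x))) (involutive G x)

  Comp-rotate : ∀ k y → Comp G B τ y (fold y rotate k)
  Comp-rotate zero    y = here
  Comp-rotate (suc k) y = step B refl (step G refl (Comp-rotate k y))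

  -- On a {G,B}-cycle, rotate moves every vertex two steps in the same direction,
  -- so by parity it never carries a to its neighbour τ G a.
  rotate-to-reflection⇒path : ∀ k a → fold a rotate k ≡ τ G a → IsPath G B τ a
  rotate-to-reflection⇒path zero          a e = a , here , inj₁ (sym e)
  rotate-to-reflection⇒path (suc zero)    a e = τ G a , step G refl here , inj₂ e
  rotate-to-reflection⇒path (suc (suc k)) a e
    = IsPath-backwards (Comp-rotate 1 a) (rotate-to-reflection⇒path k (rotate a) shifted)
    where
    shifted : fold (rotate a) rotate k ≡ τ G (rotate a)
    shifted = begin
      fold (rotate a) rotate k  ≡⟨ fold-shift rotate a k ⟩
      fold a rotate (suc k)     ≡⟨ rotate-injective (trans e (sym reflect)) ⟩
      τ G (rotate a)            ∎
      where
      reflect : rotate (τ G (rotate a)) ≡ τ G a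
      reflect = trans (cong (τ B) (involutive G (rotate a))) (involutive B (τ G a))

module FusionPathProperties (T : SquareTiled n) (c : Fin n → Bool)
                            (fusion : FusionPath (SquareTiled.τ T) c) where
  open SquareTiled T
  open Rotation T

  x₀ : Fin n
  x₀ = proj₁ fusion

  c⇔Comp : ∀ y → (c y ≡ true) ⇔ Comp R G τ x₀ y
  c⇔Comp = proj₁ (proj₂ fusion)

  x₀∈c : c x₀ ≡ true
  x₀∈c = from (c⇔Comp x₀) here

  meets-cycle : ∀ x → IsCycle G B τ x →
    (∀ y → ¬ InBoth τ c x y)
    ⊎ (∃ λ z → (τ G z ≢ z) × (∀ y → InBoth τ c x y ⇔ (y ≡ z ⊎ y ≡ τ G z)))
  meets-cycle = proj₁ (proj₂ (proj₂ (proj₂ fusion)))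

  meets-path : ∀ x → IsPath G B τ x →
    (∀ y → ¬ InBoth τ c x y) ⊎ (∃ λ z → (τ G z ≡ z) × (∀ y → InBoth τ c x y ⇔ (y ≡ z)))
  meets-path = proj₂ (proj₂ (proj₂ (proj₂ fusion)))

  c-closed : ∀ k → pair R G k ≡ true → ∀ {y} → c y ≡ true → c (τ k y) ≡ true
  c-closed k k∈RG {y} cy = from (c⇔Comp (τ k y)) (step k k∈RG (to (c⇔Comp y) cy))

  cᶜ-closed-G : ∀ {x} → c x ≡ false → c (τ G x) ≡ false
  cᶜ-closed-G {x} cx with c (τ G x) in cGx
  ... | false = refl
  ... | true  = trans (sym (subst (λ t → c t ≡ true) (involutive G x) (c-closed G refl cGx))) cx

  green-edge⇒cycle : ∀ {y} → c y ≡ true → τ G y ≢ y → IsCycle G B τ y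
  green-edge⇒cycle {y} cy Gy≢y is-path with meets-path y is-path
  ... | inj₁ disjoint         = disjoint y (cy , here)
  ... | inj₂ (z , _ , only-z) =
    Gy≢y (trans (to (only-z (τ G y)) (c-closed G refl cy , step G refl here))
                (sym (to (only-z y) (cy , here))))

  c∩green-cycle : ∀ {y w} → c y ≡ true → τ G y ≢ y →
    c w ≡ true → Comp G B τ y w → w ≡ y ⊎ w ≡ τ G y
  c∩green-cycle {y} {w} cy Gy≢y cw p with meets-cycle y (green-edge⇒cycle cy Gy≢y)
  ... | inj₁ disjoint = ⊥-elim (disjoint y (cy , here))
  ... | inj₂ (z , _ , edge) with to (edge y) (cy , here) | to (edge w) (cw , p)
  ... | inj₁ y≡z   | inj₁ w≡z   = inj₁ (trans w≡z (sym y≡z))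
  ... | inj₁ y≡z   | inj₂ w≡Gz  = inj₂ (trans w≡Gz (cong (τ G) (sym y≡z)))
  ... | inj₂ y≡Gz  | inj₁ w≡z   = inj₂ (trans w≡z (sym (trans (cong (τ G) y≡Gz) (involutive G z))))
  ... | inj₂ y≡Gz  | inj₂ w≡Gz  = inj₁ (trans w≡Gz (sym y≡Gz))

  module Regluing (σ : Triple n)
                  (σ-B : ∀ x → σ B x ≡ τ B x)
                  (σ-G-off : ∀ x → c x ≡ false → σ G x ≡ τ G x)
                  (σ-G-closed : ∀ x → c x ≡ true → c (σ G x) ≡ true)
                  (σ-G-involutive-on-c : ∀ x → c x ≡ true → σ G (σ G x) ≡ x) where

    σ-involutive : ∀ k → pair G B k ≡ true → ∀ x → σ k (σ k x) ≡ x
    σ-involutive G _ x with c x in cx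
    ... | true  = σ-G-involutive-on-c x cx
    ... | false = begin
      σ G (σ G x)  ≡⟨ cong (σ G) (σ-G-off x cx) ⟩
      σ G (τ G x)  ≡⟨ σ-G-off (τ G x) (cᶜ-closed-G cx) ⟩
      τ G (τ G x)  ≡⟨ involutive G x ⟩
      x            ∎
    σ-involutive B _ x = begin
      σ B (σ B x)  ≡⟨ σ-B (σ B x) ⟩
      τ B (σ B x)  ≡⟨ cong (τ B) (σ-B x) ⟩
      τ B (τ B x)  ≡⟨ involutive B x ⟩
      x            ∎

    Comp-sym : ∀ {x y} → Comp G B σ x y → Comp G B σ y x
    Comp-sym = Orbit-sym σ-involutive

    Comp-rotate-off-c : ∀ {w} → c w ≡ false → Comp G B σ w (rotate w)
    Comp-rotate-off-c {w} cw =
      subst (Comp G B σ w) (trans (σ-B (σ G w)) (cong (τ B) (σ-G-off w cw)))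
            (step B refl (step G refl here))

    -- Walking from τ G y around the τ-{G,B}-cycle of y, the only vertex of c
    -- met before returning to y could be τ G y itself, which would make the
    -- component a path; elsewhere σ agrees with τ.
    rotation-returns : ∀ {y} → c y ≡ true → τ G y ≢ y → ∀ m →
      Comp G B σ (τ G y) y ⊎ Comp G B σ (τ G y) (fold y rotate (suc m))
    rotation-returns {y} cy Gy≢y zero =
      inj₂ (subst (Comp G B σ (τ G y)) (σ-B (τ G y)) (step B refl here))
    rotation-returns {y} cy Gy≢y (suc m) with rotation-returns cy Gy≢y m
    ... | inj₁ returned = inj₁ returned
    ... | inj₂ r with c (fold y rotate (suc m)) in cw
    ...   | false = inj₂ (Orbit-trans r (Comp-rotate-off-c cw))
    ...   | true with c∩green-cycle cy Gy≢y cw (Comp-rotate (suc m) y)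
    ...     | inj₁ w≡y  = inj₁ (subst (Comp G B σ (τ G y)) w≡y r)
    ...     | inj₂ w≡Gy =
      ⊥-elim (green-edge⇒cycle cy Gy≢y (rotate-to-reflection⇒path (suc m) y w≡Gy))

    green-edge-connected : ∀ {y} → c y ≡ true → Comp G B σ y (τ G y)
    green-edge-connected {y} cy with τ G y ≟ y
    ... | yes Gy≡y = subst (Comp G B σ y) (sym Gy≡y) here
    ... | no Gy≢y
      with m , period ← injective⇒periodic rotate-injective y
      with rotation-returns cy Gy≢y m
    ...   | inj₁ returned = Comp-sym returned
    ...   | inj₂ r        = Comp-sym (subst (Comp G B σ (τ G y)) period r)

    module _ (red-edge-connected : ∀ y → c y ≡ true → Comp G B σ y (τ R y)) where

      c⊆component : ∀ {y} → Comp R G τ x₀ y → Comp G B σ x₀ y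
      c⊆component here = here
      c⊆component (step {y} G _ p) =
        Orbit-trans (c⊆component p) (green-edge-connected (from (c⇔Comp y) p))
      c⊆component (step {y} R _ p) =
        Orbit-trans (c⊆component p) (red-edge-connected y (from (c⇔Comp y) p))

      single-component : SingleGBComponent σ (UnionGB τ c)
      single-component = x₀ , λ y → mk⇔ forward backward
        where
        forward : ∀ {y} → UnionGB τ c y → Comp G B σ x₀ y
        forward u
          with w , cw , q ← UnionGB-transfer (sym ∘ σ-B) (λ x cx → sym (σ-G-off x cx))
                                             (λ _ → c-closed G refl) u
          = Orbit-trans (c⊆component (to (c⇔Comp w) cw)) q

        backward : ∀ {y} → Comp G B σ x₀ y → UnionGB τ c y
        backward p = UnionGB-transfer σ-B σ-G-off σ-G-closed (x₀ , x₀∈c , p)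

  module ShearRG where
    σ : Triple n
    σ = Shear c R G τ

    σ-G-on-c : ∀ {x} → c x ≡ true → σ G x ≡ τ G (τ R (τ G x))
    σ-G-on-c cx rewrite cx = refl

    σ-G-closed : ∀ x → c x ≡ true → c (σ G x) ≡ true
    σ-G-closed x cx rewrite σ-G-on-c cx =
      c-closed G refl (c-closed R refl (c-closed G refl cx))

    σ-G-involutive-on-c : ∀ x → c x ≡ true → σ G (σ G x) ≡ x
    σ-G-involutive-on-c x cx = begin
      σ G (σ G x)                           ≡⟨ σ-G-on-c (σ-G-closed x cx) ⟩
      τ G (τ R (τ G (σ G x)))               ≡⟨ cong (τ G ∘ τ R ∘ τ G) (σ-G-on-c cx) ⟩
      τ G (τ R (τ G (τ G (τ R (τ G x)))))   ≡⟨ cong (τ G ∘ τ R) (involutive G _) ⟩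
      τ G (τ R (τ R (τ G x)))               ≡⟨ cong (τ G) (involutive R _) ⟩
      τ G (τ G x)                           ≡⟨ involutive G x ⟩
      x                                     ∎

    open Regluing σ (λ x → Shear-third c R G τ x refl refl) (λ x → Shear-off c R G τ G {x})
                  σ-G-closed σ-G-involutive-on-c

    UnionGB-single-component : SingleGBComponent σ (UnionGB τ c)
    UnionGB-single-component = single-component red-edge-connected
      where
      red-edge-connected : ∀ y → c y ≡ true → Comp G B σ y (τ R y)
      red-edge-connected y cy =
        Orbit-trans (Orbit-trans (green-edge-connected cy) new-green-edge)
                    (Comp-sym (green-edge-connected (c-closed R refl cy)))
        where
        new-green-edge : Comp G B σ (τ G y) (τ G (τ R y))
        new-green-edge =
          subst (Comp G B σ (τ G y))
                (trans (σ-G-on-c (c-closed G refl cy)) (cong (τ G ∘ τ R) (involutive G y)))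
                (step G refl here)

  module ShearGR where
    σ : Triple n
    σ = Shear c G R τ

    σ-G-on-c : ∀ {x} → c x ≡ true → σ G x ≡ τ R x
    σ-G-on-c cx rewrite cx = refl

    σ-G-closed : ∀ x → c x ≡ true → c (σ G x) ≡ true
    σ-G-closed x cx rewrite σ-G-on-c cx = c-closed R refl cx

    σ-G-involutive-on-c : ∀ x → c x ≡ true → σ G (σ G x) ≡ x
    σ-G-involutive-on-c x cx =
      trans (σ-G-on-c (σ-G-closed x cx)) (trans (cong (τ R) (σ-G-on-c cx)) (involutive R x))

    open Regluing σ (λ x → Shear-third c G R τ x refl refl) (λ x → Shear-off c G R τ G {x})
                  σ-G-closed σ-G-involutive-on-c

    UnionGB-single-component : SingleGBComponent σ (UnionGB τ c)
    UnionGB-single-component = single-component red-edge-connected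
      where
      red-edge-connected : ∀ y → c y ≡ true → Comp G B σ y (τ R y)
      red-edge-connected y cy = subst (Comp G B σ y) (σ-G-on-c cy) (step G refl here)

lemma3p6 : (n : ℕ) (T : SquareTiled n) (c : Fin n → Bool) →
    FusionPath (SquareTiled.τ T) c →
    SingleGBComponent (Shear c R G (SquareTiled.τ T)) (UnionGB (SquareTiled.τ T) c)
    × SingleGBComponent (Shear c G R (SquareTiled.τ T)) (UnionGB (SquareTiled.τ T) c)
lemma3p6 n T c fusion =
  ShearRG.UnionGB-single-component , ShearGR.UnionGB-single-component
  where open FusionPathProperties T c fusion
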